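{- Let $k \ge 2$ be an integer, $p$ a prime, $M \ge 1$ an integer, $r$ a prime with $r > Mk$, $i \ge 1$ an integer, $t = r^i$ and $q = p^t$. Let $\theta$ be a generator of $\mathbb{F}_{q^2}^{*}$ and let $B = \{ b \in \mathbb{Z}_{q^2-1} : \theta^{b} + \theta^{qb} = 1 \}$. Let $\pi : B \to B$ be the permutation $\pi(b) = pb$. Construct $A \subset B$ as follows: for each cycle $\sigma = (b_1, b_2, \dots, b_m)$ of $\pi$ (so $b_{j+1} = p b_j$ and $p b_m = b_1$, with some chosen starting element $b_1$), if $m < k$ remove all elements of $\sigma$ from $B$, and if $m \ge k$ remove those $b_j$ for which $j$ is not divisible by $k$; let $A$ be the set of remaining elements of $B$. Then for each $c \in \{1, p, p^2, \dots, p^{k-1}\}$, every solution of \[ x_1 - x_2 = c(x_3 - x_4) \] in $\mathbb{Z}_{q^2-1}$ with $x_1,x_2,x_3,x_4 \in A$ is trivial.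
   Context: $\mathbb{Z}_{q^2-1} = \mathbb{Z}/(q^2-1)\mathbb{Z}$, and $\theta^b$ is well defined for $b \in \mathbb{Z}_{q^2-1}$. The map $b \mapsto pb$ sends $B$ bijectively to itself, so $\pi$ is a permutation of $B$. A solution $(x_1,x_2,x_3,x_4)$ of $x_1 - x_2 = c(x_3 - x_4)$ is trivial if either $x_1 = x_2$ and $x_3 = x_4$, or $c = 1$ and $x_1 = x_3$, $x_2 = x_4$. -}

module Defs where

open import Level using (Level; _⊔_)
open import Data.Nat using (ℕ; _+_; _*_; _∸_; _^_; _≤_; _<_)
open import Data.Nat.Divisibility using (_∣_)
open import Data.Product using (_×_; ∃; Σ)
open import Relation.Nullary using (¬_)
open import Relation.Binary.PropositionalEquality using (_≡_)
open import Algebra.Bundles using (CommutativeRing; Semiring)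

Cong : ℕ → ℕ → ℕ → Set
Cong N a b = ∃ λ u → ∃ λ v → a + u * N ≡ b + v * N

IsCycleLen : (N p b m : ℕ) → Set
IsCycleLen N p b m =
  1 ≤ m × Cong N ((p ^ m) * b) b
  × (∀ m′ → 1 ≤ m′ → m′ < m → ¬ Cong N ((p ^ m′) * b) b)

module FieldDefs {c ℓ : Level} (R : CommutativeRing c ℓ) where
  open CommutativeRing R using (Carrier; _≈_; 0#; 1#; semiring) renaming (_+_ to _+ᴿ_; _*_ to _*ᴿ_)
  open import Algebra.Definitions.RawSemiring (Semiring.rawSemiring semiring) using () renaming (_^_ to _^ᴿ_)

  IsFieldRing : Set (c ⊔ ℓ)
  IsFieldRing = ¬ (1# ≈ 0#) × (∀ x → ¬ (x ≈ 0#) → ∃ λ y → x *ᴿ y ≈ 1#)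

  -- θ generates the multiplicative group R*, which has exactly N elements:
  -- θ^0, …, θ^(N-1) are pairwise distinct and exhaust the nonzero elements.
  -- (Together with IsFieldRing this says R is a field with N+1 elements.)
  IsGenerator : ℕ → Carrier → Set (c ⊔ ℓ)
  IsGenerator N θ =
    (∀ a b → a < N → b < N → θ ^ᴿ a ≈ θ ^ᴿ b → a ≡ b)
    × (∀ x → ¬ (x ≈ 0#) → ∃ λ b → b < N × θ ^ᴿ b ≈ x)

  InB : (q N : ℕ) → Carrier → ℕ → Set ℓ
  InB q N θ b = b < N × (θ ^ᴿ b) +ᴿ (θ ^ᴿ (q * b)) ≈ 1#

  IsCycleStartChoice : (p q N : ℕ) → Carrier → (ℕ → ℕ) → Set ℓ
  IsCycleStartChoice p q N θ st =
    (∀ b → InB q N θ b → InB q N θ (st b) × ∃ λ e → Cong N ((p ^ e) * b) (st b))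
    × (∀ b b′ → InB q N θ b → InB q N θ b′ → Cong N b′ (p * b) → st b′ ≡ st b)

  -- b ∈ A: b ∈ B, its cycle σ = (b₁,…,b_m) (b₁ = st b, b_{j+1} = p b_j)
  -- has length m ≥ k, and b = b_j with k ∣ j.
  InA : (k p q N : ℕ) → Carrier → (ℕ → ℕ) → ℕ → Set ℓ
  InA k p q N θ st b =
    InB q N θ b
    × (∃ λ m → IsCycleLen N p b m × k ≤ m
         × (∃ λ j → 1 ≤ j × j ≤ m × k ∣ j × Cong N b ((p ^ (j ∸ 1)) * st b)))

-- Write u = θ^x. Membership in B says Tr u = u + u^q = 1, and a solution of
-- x₁ − x₂ = p^e (x₃ − x₄) says u₁ · Φ u₄ = u₂ · Φ u₃ for the Frobenius power Φ u = u^(p^e),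
-- which preserves Tr u = 1. For four elements of trace one, ad = bc also gives (ad)^q = (bc)^q,
-- and expanding Tr a · Tr d = 1 then yields a + d = b + c, so {a, d} = {b, c}. The only
-- nontrivial case left is u₁ = Φ u₃ with 0 < e < k, i.e. x₁ = p^e x₃: two elements of A on one
-- π-cycle e < k steps apart, which the construction of A (positions divisible by k) excludes.
-- The cycle bookkeeping is arithmetic modulo N = q² − 1, in which p is invertible as
-- p^(2t) = N + 1. That F has characteristic p, needed for Φ to be additive, follows by
-- evaluating ∑_{a<N} (θ^a + 1)^N in two ways: termwise it is N − 1, binomially it is 2N.
-- Equality in F is not decidable, so the field facts hold under double negation; this is
-- discharged at the end since the conclusion is a decidable statement about ℕ.

module Submission where

open import Level using (Level)
open import Data.Nat.Base as ℕ using (ℕ; zero; suc; NonZero; _≤_; _<_)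
import Data.Nat.Properties as ℕ
open import Data.Nat.DivMod using (_%_; m%n<n)
open import Data.Nat.Divisibility using (_∣_; divides-refl)
open import Data.Nat.Primality using (Prime; prime⇒nonZero)
open import Data.Nat.Combinatorics using (_C_; nCn≡1)
open import Data.Fin.Base using (Fin; zero; suc; toℕ; fromℕ; fromℕ<; inject₁; punchIn)
open import Data.Fin.Properties using (toℕ<n; toℕ-fromℕ; toℕ-fromℕ<; toℕ-injective; toℕ-inject₁; punchInᵢ≢i)
open import Data.Product.Base using (_,_; proj₁; proj₂; ∃) renaming (_×_ to _∧_)
open import Data.Sum.Base as Sum using (_⊎_; inj₁; inj₂)
open import Function.Base using (_∘_)
open import Data.Empty using (⊥; ⊥-elim)
open import Relation.Nullary.Negation using (¬_; contradiction)
open import Relation.Nullary.Decidable using (Dec; yes; no; decidable-stable; _×-dec_; _⊎-dec_)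
open import Relation.Binary.PropositionalEquality as ≡ using (_≡_; _≢_)
open import Algebra.Bundles using (CommutativeRing)
open import Defs

module Arithmetic where
  open import Data.Nat.Base
  open import Data.Nat.Properties
  open import Data.Nat.Divisibility
  open import Data.Nat.DivMod
  open import Data.Nat.Primality using (prime⇒nonTrivial; euclidsLemma)
  open import Data.Nat.Combinatorics using (_C_; k![n∸k]!∣n!)
  open import Data.Nat.Combinatorics.Specification using (nCk≡n!/k![n-k]!)
  open import Data.Sum.Base using ([_,_]′)
  open import Relation.Binary.PropositionalEquality
  open import Relation.Binary.Definitions using (tri<; tri≈; tri>)
  open import Relation.Binary.Bundles using (Setoid)
  open import Relation.Binary.Structures using (IsEquivalence)

  prime∤! : ∀ {p} → Prime p → ∀ {n} → n < p → p ∤ n !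
  prime∤! p-prime {zero}  _   p∣1 = nonTrivial⇒≢1 {{prime⇒nonTrivial p-prime}} (∣1⇒≡1 p∣1)
  prime∤! p-prime {suc n} n<p p∣n! with euclidsLemma (suc n) (n !) p-prime p∣n!
  ... | inj₁ p∣1+n = <⇒≱ n<p (∣⇒≤ p∣1+n)
  ... | inj₂ p∣n!′ = prime∤! p-prime (<-trans (n<1+n n) n<p) p∣n!′

  n∣n! : ∀ n → .{{NonZero n}} → n ∣ n !
  n∣n! (suc n) = m∣m*n (n !)

  prime∣C : ∀ {p k} → Prime p → 0 < k → k < p → p ∣ p C k
  prime∣C {p} {k} p-prime 0<k k<p with euclidsLemma (p C k) (k ! * (p ∸ k) !) p-prime p∣C*k![p∸k]!
    where
    instance
      k!*[p∸k]!≢0 : NonZero (k ! * (p ∸ k) !)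
      k!*[p∸k]!≢0 = k !* (p ∸ k) !≢0
    p∣C*k![p∸k]! : p ∣ (p C k) * (k ! * (p ∸ k) !)
    p∣C*k![p∸k]! = subst (p ∣_) (sym (begin
      (p C k) * (k ! * (p ∸ k) !)        ≡⟨ cong (_* (k ! * (p ∸ k) !)) (nCk≡n!/k![n-k]! (<⇒≤ k<p)) ⟩
      p ! / (k ! * (p ∸ k) !) * (k ! * (p ∸ k) !) ≡⟨ m/n*n≡m (k![n∸k]!∣n! (<⇒≤ k<p)) ⟩
      p ! ∎))
      (n∣n! p {{prime⇒nonZero p-prime}})
      where open ≡-Reasoning
  ... | inj₁ p∣C = p∣C
  ... | inj₂ p∣k![p∸k]! with euclidsLemma (k !) ((p ∸ k) !) p-prime p∣k![p∸k]!
  ...   | inj₁ p∣k! = contradiction p∣k! (prime∤! p-prime k<p)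
  ...   | inj₂ p∣[p∸k]! = contradiction p∣[p∸k]! (prime∤! p-prime (∸-monoʳ-< 0<k (<⇒≤ k<p)))

  module _ {N : ℕ} .{{_ : NonZero N}} where

    Cong⇒%≡ : ∀ {a b} → Cong N a b → a % N ≡ b % N
    Cong⇒%≡ {a} {b} (u , v , eq) = begin
      a % N           ≡⟨ [m+kn]%n≡m%n a u N ⟨
      (a + u * N) % N ≡⟨ cong (_% N) eq ⟩
      (b + v * N) % N ≡⟨ [m+kn]%n≡m%n b v N ⟩
      b % N           ∎
      where open ≡-Reasoning

    %≡⇒Cong : ∀ {a b} → a % N ≡ b % N → Cong N a b
    %≡⇒Cong {a} {b} eq = b / N , a / N , (begin
      a + b / N * N                 ≡⟨ cong (_+ b / N * N) (m≡m%n+[m/n]*n a N) ⟩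
      a % N + a / N * N + b / N * N ≡⟨ cong (λ r → r + a / N * N + b / N * N) eq ⟩
      b % N + a / N * N + b / N * N ≡⟨ +-assoc (b % N) _ _ ⟩
      b % N + (a / N * N + b / N * N) ≡⟨ cong (b % N +_) (+-comm (a / N * N) _) ⟩
      b % N + (b / N * N + a / N * N) ≡⟨ +-assoc (b % N) _ _ ⟨
      b % N + b / N * N + a / N * N ≡⟨ cong (_+ a / N * N) (m≡m%n+[m/n]*n b N) ⟨
      b + a / N * N                 ∎)
      where open ≡-Reasoning

    Cong-isEquivalence : IsEquivalence (Cong N)
    Cong-isEquivalence = record
      { refl  = 0 , 0 , refl
      ; sym   = λ (u , v , eq) → v , u , sym eq
      ; trans = λ a≡b b≡c → %≡⇒Cong (trans (Cong⇒%≡ a≡b) (Cong⇒%≡ b≡c))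
      }

    Cong-setoid : Setoid _ _
    Cong-setoid = record { isEquivalence = Cong-isEquivalence }

    open IsEquivalence Cong-isEquivalence public
      renaming (refl to Cong-refl; sym to Cong-sym; trans to Cong-trans)

    Cong-% : ∀ a → Cong N (a % N) a
    Cong-% a = %≡⇒Cong (m%n%n≡m%n a N)

    Cong-<⇒≡ : ∀ {a b} → a < N → b < N → Cong N a b → a ≡ b
    Cong-<⇒≡ {a} {b} a<N b<N a≡b = begin
      a     ≡⟨ m<n⇒m%n≡m a<N ⟨
      a % N ≡⟨ Cong⇒%≡ a≡b ⟩
      b % N ≡⟨ m<n⇒m%n≡m b<N ⟩
      b     ∎
      where open ≡-Reasoning

  Cong-*ˡ : ∀ {N a b} c → Cong N a b → Cong N (c * a) (c * b)
  Cong-*ˡ {N} {a} {b} c (u , v , eq) = c * u , c * v , (begin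
    c * a + c * u * N   ≡⟨ cong (c * a +_) (*-assoc c u N) ⟩
    c * a + c * (u * N) ≡⟨ *-distribˡ-+ c a (u * N) ⟨
    c * (a + u * N)     ≡⟨ cong (c *_) eq ⟩
    c * (b + v * N)     ≡⟨ *-distribˡ-+ c b (v * N) ⟩
    c * b + c * (v * N) ≡⟨ cong (c * b +_) (*-assoc c v N) ⟨
    c * b + c * v * N   ∎)
    where open ≡-Reasoning

  -- Positions on a cycle of length m are counted from 0, so the kept ones are the i with k ∣ suc i.
  multiples-not-shifted : ∀ {k m e i i′} → k ≤ m → 0 < e → e < k → i < m → i′ < m
                        → k ∣ suc i → k ∣ suc i′ → Cong m i′ (e + i) → ⊥
  multiples-not-shifted {k} {m} {e} {i} {i′} k≤m 0<e e<k i<m i′<m k∣1+i k∣1+i′ i′∼e+i =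
    [ wrapped , unwrapped ]′ (≤-<-connex m (e + i))
    where
    instance
      m≢0 : NonZero m
      m≢0 = >-nonZero (<-≤-trans (<-trans 0<e e<k) k≤m)
    unwrapped : e + i < m → ⊥
    unwrapped e+i<m = <⇒≱ e<k (∣⇒≤ {{>-nonZero 0<e}} k∣e)
      where
      i′≡e+i : i′ ≡ e + i
      i′≡e+i = Cong-<⇒≡ i′<m e+i<m i′∼e+i
      k∣e : k ∣ e
      k∣e = ∣m+n∣m⇒∣n (subst (k ∣_) (cong suc (trans i′≡e+i (+-comm e i))) k∣1+i′) k∣1+i
    wrapped : m ≤ e + i → ⊥
    wrapped m≤e+i = <⇒≱ (≤-<-trans 1+i′≤e e<k) (∣⇒≤ k∣1+i′)
      where
      e+i∸m<e : e + i ∸ m < e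
      e+i∸m<e = subst (e + i ∸ m <_) (m+n∸n≡m e m) (∸-monoˡ-< (+-monoʳ-< e i<m) m≤e+i)
      i′≡e+i∸m : i′ ≡ e + i ∸ m
      i′≡e+i∸m = Cong-<⇒≡ i′<m (<-≤-trans e+i∸m<e (<⇒≤ (<-≤-trans e<k k≤m)))
                   (Cong-trans i′∼e+i (%≡⇒Cong (sym (m≤n⇒[n∸m]%m≡n%m m≤e+i))))
      1+i′≤e : suc i′ ≤ e
      1+i′≤e = subst (λ j → suc j ≤ e) (sym i′≡e+i∸m) e+i∸m<e

  p^a*[p^b*x]≡p^[a+b]*x : ∀ p a b x → p ^ a * (p ^ b * x) ≡ p ^ (a + b) * x
  p^a*[p^b*x]≡p^[a+b]*x p a b x = trans (sym (*-assoc (p ^ a) (p ^ b) x)) (cong (_* x) (sym (^-distribˡ-+-* p a b)))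

  p^a*[p^b*x]≡p^b*[p^a*x] : ∀ p a b x → p ^ a * (p ^ b * x) ≡ p ^ b * (p ^ a * x)
  p^a*[p^b*x]≡p^b*[p^a*x] p a b x = begin
    p ^ a * (p ^ b * x) ≡⟨ p^a*[p^b*x]≡p^[a+b]*x p a b x ⟩
    p ^ (a + b) * x     ≡⟨ cong (λ n → p ^ n * x) (+-comm a b) ⟩
    p ^ (b + a) * x     ≡⟨ p^a*[p^b*x]≡p^[a+b]*x p b a x ⟨
    p ^ b * (p ^ a * x) ∎
    where open ≡-Reasoning

  IsCycleLen-unique : ∀ {N p b m m′} → IsCycleLen N p b m → IsCycleLen N p b m′ → m ≡ m′
  IsCycleLen-unique {m = m} {m′} (1≤m , per , min) (1≤m′ , per′ , min′) with <-cmp m m′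
  ... | tri< m<m′ _ _ = contradiction per (min′ m 1≤m m<m′)
  ... | tri≈ _ m≡m′ _ = m≡m′
  ... | tri> _ _ m′<m = contradiction per′ (min m′ 1≤m′ m′<m)

  module Orbits {N : ℕ} .{{_ : NonZero N}} (p p⁻¹ : ℕ) (p*p⁻¹∼1 : Cong N (p * p⁻¹) 1) where
    open import Relation.Binary.Reasoning.Setoid Cong-setoid

    *-cancelˡ-p : ∀ {a b} → Cong N (p * a) (p * b) → Cong N a b
    *-cancelˡ-p {a} {b} pa∼pb =
      Cong-trans (x∼p⁻¹*[p*x] a) (Cong-trans (Cong-*ˡ p⁻¹ pa∼pb) (Cong-sym (x∼p⁻¹*[p*x] b)))
      where
      x∼p⁻¹*[p*x] : ∀ x → Cong N x (p⁻¹ * (p * x))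
      x∼p⁻¹*[p*x] x = begin
        x               ≡⟨ *-identityˡ x ⟨
        1 * x           ≈⟨ Cong-sym (subst₂ (Cong N) (*-comm x _) (*-comm x 1) (Cong-*ˡ x p*p⁻¹∼1)) ⟩
        p * p⁻¹ * x     ≡⟨ cong (_* x) (*-comm p p⁻¹) ⟩
        p⁻¹ * p * x     ≡⟨ *-assoc p⁻¹ p x ⟩
        p⁻¹ * (p * x)   ∎

    *-cancelˡ-p^ : ∀ e {a b} → Cong N (p ^ e * a) (p ^ e * b) → Cong N a b
    *-cancelˡ-p^ zero    {a} {b} h = subst₂ (Cong N) (*-identityˡ a) (*-identityˡ b) h
    *-cancelˡ-p^ (suc e) {a} {b} h =
      *-cancelˡ-p^ e (*-cancelˡ-p (subst₂ (Cong N) (*-assoc p (p ^ e) a) (*-assoc p (p ^ e) b) h))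

    IsCycleLen-orbit : ∀ {b c m e} → IsCycleLen N p b m → Cong N c (p ^ e * b) → IsCycleLen N p c m
    IsCycleLen-orbit {b} {c} {m} {e} (1≤m , per , min) c∼p^eb = 1≤m , per′ , min′
      where
      per′ : Cong N (p ^ m * c) c
      per′ = begin
        p ^ m * c           ≈⟨ Cong-*ˡ (p ^ m) c∼p^eb ⟩
        p ^ m * (p ^ e * b) ≡⟨ p^a*[p^b*x]≡p^b*[p^a*x] p m e b ⟩
        p ^ e * (p ^ m * b) ≈⟨ Cong-*ˡ (p ^ e) per ⟩
        p ^ e * b           ≈⟨ Cong-sym c∼p^eb ⟩
        c                   ∎
      min′ : ∀ m′ → 1 ≤ m′ → m′ < m → ¬ Cong N (p ^ m′ * c) c
      min′ m′ 1≤m′ m′<m p^m′c∼c = min m′ 1≤m′ m′<m (*-cancelˡ-p^ e (begin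
        p ^ e * (p ^ m′ * b) ≡⟨ p^a*[p^b*x]≡p^b*[p^a*x] p e m′ b ⟩
        p ^ m′ * (p ^ e * b) ≈⟨ Cong-*ˡ (p ^ m′) c∼p^eb ⟨
        p ^ m′ * c           ≈⟨ p^m′c∼c ⟩
        c                    ≈⟨ c∼p^eb ⟩
        p ^ e * b            ∎))

    p^[s*m]*b∼b : ∀ {b m} → Cong N (p ^ m * b) b → ∀ s → Cong N (p ^ (s * m) * b) b
    p^[s*m]*b∼b {b} per zero    = begin
      p ^ 0 * b ≡⟨ *-identityˡ b ⟩
      b         ∎
    p^[s*m]*b∼b {b} {m} per (suc s) = begin
      p ^ (m + s * m) * b        ≡⟨ p^a*[p^b*x]≡p^[a+b]*x p m (s * m) b ⟨
      p ^ m * (p ^ (s * m) * b)  ≈⟨ Cong-*ˡ (p ^ m) (p^[s*m]*b∼b per s) ⟩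
      p ^ m * b                  ≈⟨ per ⟩
      b                          ∎

    IsCycleLen-∣ : ∀ {b m d} → IsCycleLen N p b m → Cong N (p ^ d * b) b → m ∣ d
    IsCycleLen-∣ {b} {m} {d} (1≤m , per , min) p^db∼b = m%n≡0⇒n∣m d m d%m≡0
      where
      instance
        m≢0 : NonZero m
        m≢0 = >-nonZero 1≤m
      p^[d%m]b∼b : Cong N (p ^ (d % m) * b) b
      p^[d%m]b∼b = begin
        p ^ (d % m) * b                         ≈⟨ Cong-*ˡ (p ^ (d % m)) (p^[s*m]*b∼b per (d / m)) ⟨
        p ^ (d % m) * (p ^ (d / m * m) * b)     ≡⟨ p^a*[p^b*x]≡p^[a+b]*x p (d % m) (d / m * m) b ⟩
        p ^ (d % m + d / m * m) * b             ≡⟨ cong (λ n → p ^ n * b) (m≡m%n+[m/n]*n d m) ⟨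
        p ^ d * b                               ≈⟨ p^db∼b ⟩
        b                                       ∎
      d%m≡0 : d % m ≡ 0
      d%m≡0 = decidable-stable (d % m ≟ 0) λ d%m≢0 →
        min (d % m) (n≢0⇒n>0 d%m≢0) (m%n<n d m) p^[d%m]b∼b

    IsCycleLen-index : ∀ {b m i j} → IsCycleLen N p b m → Cong N (p ^ i * b) (p ^ j * b) → Cong m i j
    IsCycleLen-index {b} {m} {i} {j} cl@(1≤m , _) h =
      [ (λ i≤j → index-≤ i≤j h) , (λ j≤i → Cong-sym (index-≤ j≤i (Cong-sym h))) ]′ (≤-total i j)
      where
      instance
        m≢0 : NonZero m
        m≢0 = >-nonZero 1≤m
      index-≤ : ∀ {i j} → i ≤ j → Cong N (p ^ i * b) (p ^ j * b) → Cong m i j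
      index-≤ {i} {j} i≤j h with IsCycleLen-∣ cl (Cong-sym (*-cancelˡ-p^ i (begin
          p ^ i * b                   ≈⟨ h ⟩
          p ^ j * b                   ≡⟨ cong (λ n → p ^ n * b) (m+[n∸m]≡n i≤j) ⟨
          p ^ (i + (j ∸ i)) * b       ≡⟨ p^a*[p^b*x]≡p^[a+b]*x p i (j ∸ i) b ⟨
          p ^ i * (p ^ (j ∸ i) * b)   ∎)))
      ... | divides c j∸i≡c*m =
        c , 0 , trans (cong (i +_) (sym j∸i≡c*m)) (trans (m+[n∸m]≡n i≤j) (sym (+-identityʳ j)))

  prime^≥2 : ∀ {p t} → Prime p → 1 ≤ t → 2 ≤ p ^ t
  prime^≥2 {p} {t} p-prime 1≤t = begin
    2      ≤⟨ nonTrivial⇒n>1 p ⟩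
    p      ≡⟨ *-identityʳ p ⟨
    p ^ 1  ≤⟨ ^-monoʳ-≤ p 1≤t ⟩
    p ^ t  ∎
    where
    open ≤-Reasoning
    instance
      p-nonTrivial : NonTrivial p
      p-nonTrivial = prime⇒nonTrivial p-prime
      p≢0 : NonZero p
      p≢0 = prime⇒nonZero p-prime

  2<q*q∸1 : ∀ {q} → 2 ≤ q → 2 < q * q ∸ 1
  2<q*q∸1 2≤q = ∸-monoˡ-≤ 1 (*-mono-≤ 2≤q 2≤q)

open Arithmetic

module FieldProperties {c ℓ : Level} (F : CommutativeRing c ℓ) (isField : FieldDefs.IsFieldRing F) where
  open CommutativeRing F hiding (zero)
  open import Algebra.Properties.Semiring.Exp semiring public
  open import Algebra.Properties.CommutativeSemiring.Exp commutativeSemiring using (^-distrib-*)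
  open import Algebra.Properties.Semiring.Mult semiring public
  open import Algebra.Properties.CommutativeMonoid.Sum +-commutativeMonoid
  open import Algebra.Properties.Semiring.Sum semiring using (*-distribˡ-sum)
  open import Algebra.Properties.CommutativeSemiring.Binomial commutativeSemiring
    using (theorem; binomial; binomialTerm)
  open import Algebra.Properties.Ring ring
    using ( +-cancelˡ; +-cancelʳ; +-inverseˡ-unique; -0#≈0#; -‿involutive; x∙y⁻¹≈ε⇒x≈y
          ; [y-z]x≈yx-zx; -‿distribˡ-*; -‿distribʳ-*)
  open import Algebra.Solver.Ring.NaturalCoefficients.Default commutativeSemiring
  open import Relation.Binary.Reasoning.Setoid setoid

  1≉0 : ¬ (1# ≈ 0#)
  1≉0 = proj₁ isField

  x*y≉0 : ∀ {x y} → ¬ (x ≈ 0#) → ¬ (y ≈ 0#) → ¬ (x * y ≈ 0#)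
  x*y≉0 {x} {y} x≉0 y≉0 xy≈0 with proj₂ isField x x≉0 | proj₂ isField y y≉0
  ... | x⁻¹ , xx⁻¹≈1 | y⁻¹ , yy⁻¹≈1 = 1≉0 (begin
    1#                    ≈⟨ *-identityʳ 1# ⟨
    1# * 1#               ≈⟨ *-cong xx⁻¹≈1 yy⁻¹≈1 ⟨
    x * x⁻¹ * (y * y⁻¹)   ≈⟨ solve 4 (λ x x⁻¹ y y⁻¹ → x :* x⁻¹ :* (y :* y⁻¹) := x :* y :* (x⁻¹ :* y⁻¹))
                                     refl x x⁻¹ y y⁻¹ ⟩
    x * y * (x⁻¹ * y⁻¹)   ≈⟨ *-congʳ xy≈0 ⟩
    0# * (x⁻¹ * y⁻¹)      ≈⟨ zeroˡ _ ⟩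
    0#                    ∎)

  -1≉0 : ¬ (- 1# ≈ 0#)
  -1≉0 -1≈0 = 1≉0 (trans (sym (-‿involutive 1#)) (trans (-‿cong -1≈0) -0#≈0#))

  x^n≉0 : ∀ {x} n → ¬ (x ≈ 0#) → ¬ (x ^ n ≈ 0#)
  x^n≉0 zero    x≉0 = 1≉0
  x^n≉0 (suc n) x≉0 = x*y≉0 x≉0 (x^n≉0 n x≉0)

  x^n≈0⇒¬¬x≈0 : ∀ {x} n → x ^ n ≈ 0# → ¬ ¬ (x ≈ 0#)
  x^n≈0⇒¬¬x≈0 n xⁿ≈0 x≉0 = x^n≉0 n x≉0 xⁿ≈0

  x*y≈0⇒¬¬[x≈0⊎y≈0] : ∀ {x y} → x * y ≈ 0# → ¬ ¬ (x ≈ 0# ⊎ y ≈ 0#)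
  x*y≈0⇒¬¬[x≈0⊎y≈0] xy≈0 ¬[x≈0⊎y≈0] = x*y≉0 (¬[x≈0⊎y≈0] ∘ inj₁) (¬[x≈0⊎y≈0] ∘ inj₂) xy≈0

  *-cancelˡ-≉0 : ∀ {x y z} → ¬ (x ≈ 0#) → x * y ≈ x * z → y ≈ z
  *-cancelˡ-≉0 {x} {y} {z} x≉0 xy≈xz with proj₂ isField x x≉0
  ... | x⁻¹ , xx⁻¹≈1 = begin
    y              ≈⟨ *-identityˡ y ⟨
    1# * y         ≈⟨ *-congʳ xx⁻¹≈1 ⟨
    x * x⁻¹ * y    ≈⟨ solve 3 (λ x x⁻¹ y → x :* x⁻¹ :* y := x⁻¹ :* (x :* y)) refl x x⁻¹ y ⟩
    x⁻¹ * (x * y)  ≈⟨ *-congˡ xy≈xz ⟩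
    x⁻¹ * (x * z)  ≈⟨ solve 3 (λ x x⁻¹ z → x⁻¹ :* (x :* z) := x :* x⁻¹ :* z) refl x x⁻¹ z ⟩
    x * x⁻¹ * z    ≈⟨ *-congʳ xx⁻¹≈1 ⟩
    1# * z         ≈⟨ *-identityˡ z ⟩
    z              ∎

  1#^n≈1# : ∀ n → 1# ^ n ≈ 1#
  1#^n≈1# zero    = refl
  1#^n≈1# (suc n) = trans (*-identityˡ _) (1#^n≈1# n)

  0#^n≈0# : ∀ n → .{{NonZero n}} → 0# ^ n ≈ 0#
  0#^n≈0# (suc n) = zeroˡ _

  n×x≈[n×1]*x : ∀ n x → n × x ≈ (n × 1#) * x
  n×x≈[n×1]*x n x = trans (×-congʳ n (sym (*-identityˡ x))) (sym (×-assoc-* n 1# x))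

  sum-× : ∀ {m} n (f : Fin m → Carrier) → ∑[ a < m ] (n × f a) ≈ n × sum f
  sum-× n f = begin
    ∑[ a < _ ] (n × f a)          ≈⟨ sum-cong-≋ (λ a → n×x≈[n×1]*x n (f a)) ⟩
    ∑[ a < _ ] ((n × 1#) * f a)   ≈⟨ *-distribˡ-sum (n × 1#) f ⟨
    (n × 1#) * sum f              ≈⟨ n×x≈[n×1]*x n (sum f) ⟨
    n × sum f                     ∎

  sum-ends : ∀ {n} .{{_ : NonZero n}} (f : Fin (suc n) → Carrier)
           → (∀ i → 0 ℕ.< toℕ i → toℕ i ℕ.< n → f i ≈ 0#) → sum f ≈ f zero + f (fromℕ n)
  sum-ends {suc n} f inner≈0 = +-congˡ (begin
    ∑[ i < suc n ] f (suc i)                       ≈⟨ sum-init-last (λ i → f (suc i)) ⟩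
    ∑[ i < n ] f (suc (inject₁ i)) + f (fromℕ (suc n)) ≈⟨ +-congʳ (sum-cong-≋ inner≈0′) ⟩
    ∑[ i < n ] 0# + f (fromℕ (suc n))               ≈⟨ +-congʳ (sum-replicate-zero n) ⟩
    0# + f (fromℕ (suc n))                          ≈⟨ +-identityˡ _ ⟩
    f (fromℕ (suc n))                               ∎)
    where
    inner≈0′ : ∀ i → f (suc (inject₁ i)) ≈ 0#
    inner≈0′ i = inner≈0 _ ℕ.z<s (ℕ.s<s (≡.subst (ℕ._< n) (≡.sym (toℕ-inject₁ i)) (toℕ<n i)))

  sum-count : ∀ {n} (f : Fin n → Carrier) (i : Fin n)
            → f i ≈ 0# → (∀ j → j ≢ i → f j ≈ 1#) → sum f + 1# ≈ n × 1#
  sum-count {suc n} f i fi≈0 others≈1 = begin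
    sum f + 1#                                ≈⟨ +-congʳ (sum-remove {i = i} f) ⟩
    f i + ∑[ j < n ] f (punchIn i j) + 1#     ≈⟨ +-congʳ (+-cong fi≈0 (sum-cong-≋ λ j →
                                                   others≈1 (punchIn i j) (punchInᵢ≢i i j))) ⟩
    0# + ∑[ _ < n ] 1# + 1#                  ≈⟨ +-congʳ (+-identityˡ _) ⟩
    ∑[ _ < n ] 1# + 1#                        ≈⟨ +-congʳ (sum-replicate n) ⟩
    n × 1# + 1#                               ≈⟨ +-comm _ 1# ⟩
    1# + n × 1#                               ∎

  binomialTerm-first : ∀ x y n → binomialTerm x y n zero ≈ y ^ n
  binomialTerm-first x y n = trans (+-identityʳ _) (*-identityˡ _)

  binomialTerm-last : ∀ x y n → binomialTerm x y n (fromℕ n) ≈ x ^ n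
  binomialTerm-last x y n rewrite toℕ-fromℕ n | nCn≡1 n | ℕ.n∸n≡0 n = trans (+-identityʳ _) (*-identityʳ _)

  x^m^n≈x^n^m : ∀ x m n → (x ^ m) ^ n ≈ (x ^ n) ^ m
  x^m^n≈x^n^m x m n = trans (^-assocʳ x m n) (trans (^-congʳ x (ℕ.*-comm m n)) (sym (^-assocʳ x n m)))

  [x-y]*[x-z]+x*[y+z]≈x*x+y*z : ∀ x y z → (x - y) * (x - z) + x * (y + z) ≈ x * x + y * z
  [x-y]*[x-z]+x*[y+z]≈x*x+y*z x y z = begin
    (x - y) * (x - z) + x * (y + z)
      ≈⟨ solve 5 (λ x y z y′ z′ → (x :+ y′) :* (x :+ z′) :+ x :* (y :+ z)
                               := x :* x :+ x :* (y :+ y′) :+ x :* (z :+ z′) :+ y′ :* z′) refl x y z (- y) (- z) ⟩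
    x * x + x * (y - y) + x * (z - z) + - y * - z
      ≈⟨ +-cong (+-cong (+-congˡ (*-congˡ (-‿inverseʳ y))) (*-congˡ (-‿inverseʳ z))) -y*-z≈y*z ⟩
    x * x + x * 0# + x * 0# + y * z
      ≈⟨ +-congʳ (+-cong (+-congˡ (zeroʳ x)) (zeroʳ x)) ⟩
    x * x + 0# + 0# + y * z
      ≈⟨ +-congʳ (trans (+-identityʳ _) (+-identityʳ _)) ⟩
    x * x + y * z
      ∎
    where
    -y*-z≈y*z : - y * - z ≈ y * z
    -y*-z≈y*z = trans (sym (-‿distribˡ-* y (- z))) (trans (-‿cong (sym (-‿distribʳ-* y z))) (-‿involutive (y * z)))

  Tr : ℕ → Carrier → Carrier
  Tr q u = u + u ^ q

  Tr-cong : ∀ q {u v} → u ≈ v → Tr q u ≈ Tr q v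
  Tr-cong q u≈v = +-cong u≈v (^-congˡ q u≈v)

  module _ (q : ℕ) where

    Tr≈1⇒sum-product : ∀ {a d} → Tr q a ≈ 1# → Tr q d ≈ 1# → a + d + a ^ q * d ^ q ≈ 1# + a * d
    Tr≈1⇒sum-product {a} {d} Tra≈1 Trd≈1 = begin
      a + d + a ^ q * d ^ q
        ≈⟨ +-congʳ (+-cong (trans (*-congˡ Trd≈1) (*-identityʳ a)) (trans (*-congʳ Tra≈1) (*-identityˡ d))) ⟨
      a * (d + d ^ q) + (a + a ^ q) * d + a ^ q * d ^ q
        ≈⟨ solve 4 (λ a d a′ d′ → a :* (d :+ d′) :+ (a :+ a′) :* d :+ a′ :* d′
                                := a :* d :+ (a :+ a′) :* (d :+ d′)) refl a d (a ^ q) (d ^ q) ⟩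
      a * d + Tr q a * Tr q d
        ≈⟨ +-congˡ (*-cong Tra≈1 Trd≈1) ⟩
      a * d + 1# * 1#
        ≈⟨ +-comm _ _ ⟩
      1# * 1# + a * d
        ≈⟨ +-congʳ (*-identityʳ 1#) ⟩
      1# + a * d
        ∎

    Tr≈1-sidon : ∀ {a b c d} → Tr q a ≈ 1# → Tr q b ≈ 1# → Tr q c ≈ 1# → Tr q d ≈ 1#
               → a * d ≈ b * c → ¬ ¬ ((a ≈ b ∧ d ≈ c) ⊎ (a ≈ c ∧ d ≈ b))
    Tr≈1-sidon {a} {b} {c} {d} Tra≈1 Trb≈1 Trc≈1 Trd≈1 ad≈bc ¬trivial =
      x*y≈0⇒¬¬[x≈0⊎y≈0] [b-a][b-d]≈0 (¬trivial ∘ Sum.map b-a≈0⇒trivial b-d≈0⇒trivial)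
      where
      a+d≈b+c : a + d ≈ b + c
      a+d≈b+c = +-cancelʳ (a ^ q * d ^ q) _ _ (begin
        a + d + a ^ q * d ^ q   ≈⟨ Tr≈1⇒sum-product Tra≈1 Trd≈1 ⟩
        1# + a * d              ≈⟨ +-congˡ ad≈bc ⟩
        1# + b * c              ≈⟨ Tr≈1⇒sum-product Trb≈1 Trc≈1 ⟨
        b + c + b ^ q * c ^ q   ≈⟨ +-congˡ (trans (sym (^-distrib-* b c q))
                                            (trans (^-congˡ q (sym ad≈bc)) (^-distrib-* a d q))) ⟩
        b + c + a ^ q * d ^ q   ∎)
      b-a≈0⇒trivial : b - a ≈ 0# → a ≈ b ∧ d ≈ c
      b-a≈0⇒trivial b-a≈0 = a≈b , +-cancelˡ a d c (trans a+d≈b+c (+-congʳ (sym a≈b)))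
        where
        a≈b : a ≈ b
        a≈b = sym (x∙y⁻¹≈ε⇒x≈y b a b-a≈0)
      b-d≈0⇒trivial : b - d ≈ 0# → a ≈ c ∧ d ≈ b
      b-d≈0⇒trivial b-d≈0 = +-cancelʳ d a c (trans a+d≈b+c (trans (+-congʳ (sym d≈b)) (+-comm d c))) , d≈b
        where
        d≈b : d ≈ b
        d≈b = sym (x∙y⁻¹≈ε⇒x≈y b d b-d≈0)
      -- (b - a)(b - d) = b² - b(a + d) + ad vanishes because a + d = b + c and ad = bc.
      [b-a][b-d]≈0 : (b - a) * (b - d) ≈ 0#
      [b-a][b-d]≈0 = +-cancelʳ (b * (a + d)) _ _ (begin
        (b - a) * (b - d) + b * (a + d) ≈⟨ [x-y]*[x-z]+x*[y+z]≈x*x+y*z b a d ⟩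
        b * b + a * d                   ≈⟨ +-cong refl ad≈bc ⟩
        b * b + b * c                   ≈⟨ distribˡ b b c ⟨
        b * (b + c)                     ≈⟨ *-congˡ a+d≈b+c ⟨
        b * (a + d)                     ≈⟨ +-identityˡ _ ⟨
        0# + b * (a + d)                ∎)

  ×-zeroʳ : ∀ n → n × 0# ≈ 0#
  ×-zeroʳ n = trans (n×x≈[n×1]*x n 0#) (zeroʳ _)

  ×1-homo-^ : ∀ m n → (m ℕ.^ n) × 1# ≈ (m × 1#) ^ n
  ×1-homo-^ m zero    = +-identityʳ 1#
  ×1-homo-^ m (suc n) = trans (×1-homo-* m (m ℕ.^ n)) (*-congˡ (×1-homo-^ m n))

  [m^n]×1≈0⇒¬¬m×1≈0 : ∀ {m} n → (m ℕ.^ n) × 1# ≈ 0# → ¬ ¬ (m × 1# ≈ 0#)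
  [m^n]×1≈0⇒¬¬m×1≈0 {m} n mⁿ×1≈0 = x^n≈0⇒¬¬x≈0 n (trans (sym (×1-homo-^ m n)) mⁿ×1≈0)

  geometric-sum : ∀ n y → (∑[ a < n ] (y ^ toℕ a)) * y + 1# ≈ y ^ n + (∑[ a < n ] (y ^ toℕ a))
  geometric-sum zero    y = trans (+-congʳ (zeroˡ y)) (+-comm 0# 1#)
  geometric-sum (suc n) y = begin
    (1# + G′) * y + 1#          ≈⟨ +-congʳ (*-congʳ (+-congˡ (*-distribˡ-sum {n} y (λ a → y ^ toℕ a)))) ⟨
    (1# + y * G) * y + 1#       ≈⟨ solve 2 (λ y G → (con 1 :+ y :* G) :* y :+ con 1
                                              := y :* (G :* y :+ con 1) :+ con 1) refl y G ⟩
    y * (G * y + 1#) + 1#       ≈⟨ +-congʳ (*-congˡ (geometric-sum n y)) ⟩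
    y * (y ^ n + G) + 1#        ≈⟨ solve 3 (λ y yⁿ G → y :* (yⁿ :+ G) :+ con 1
                                                 := y :* yⁿ :+ (con 1 :+ y :* G)) refl y (y ^ n) G ⟩
    y * y ^ n + (1# + y * G)    ≈⟨ +-congˡ (+-congˡ (*-distribˡ-sum {n} y (λ a → y ^ toℕ a))) ⟩
    y ^ suc n + (1# + G′)       ∎
    where
    G G′ : Carrier
    G  = ∑[ a < n ] (y ^ toℕ a)
    G′ = ∑[ a < n ] (y * y ^ toℕ a)

  geometric-sum≈0 : ∀ {n y} → y ^ n ≈ 1# → ¬ (y ≈ 1#) → ∑[ a < n ] (y ^ toℕ a) ≈ 0#
  geometric-sum≈0 {n} {y} yⁿ≈1 y≉1 = *-cancelˡ-≉0 y-1≉0 (begin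
    (y - 1#) * G        ≈⟨ [y-z]x≈yx-zx G y 1# ⟩
    y * G - 1# * G      ≈⟨ +-cong (trans (*-comm y G) Gy≈G) (-‿cong (*-identityˡ G)) ⟩
    G - G               ≈⟨ -‿inverseʳ G ⟩
    0#                  ≈⟨ zeroʳ _ ⟨
    (y - 1#) * 0#       ∎)
    where
    G : Carrier
    G = ∑[ a < n ] (y ^ toℕ a)
    Gy≈G : G * y ≈ G
    Gy≈G = +-cancelʳ 1# _ _ (trans (geometric-sum n y) (trans (+-congʳ yⁿ≈1) (+-comm 1# G)))
    y-1≉0 : ¬ (y - 1# ≈ 0#)
    y-1≉0 y-1≈0 = y≉1 (x∙y⁻¹≈ε⇒x≈y y 1# y-1≈0)

  [nCn]×g[n]≈g[n] : ∀ n (g : ℕ → Carrier) → (n C toℕ (fromℕ n)) × g (toℕ (fromℕ n)) ≈ g n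
  [nCn]×g[n]≈g[n] n g rewrite toℕ-fromℕ n | nCn≡1 n = +-identityʳ (g n)

  module Generator {N : ℕ} (2<N : 2 ℕ.< N) {θ : Carrier} (gen : FieldDefs.IsGenerator F N θ) where
    instance
      N≢0 : NonZero N
      N≢0 = ℕ.>-nonZero (ℕ.<-trans ℕ.z<s 2<N)

    θ^-injective : ∀ {a b} → a ℕ.< N → b ℕ.< N → θ ^ a ≈ θ ^ b → a ≡ b
    θ^-injective = proj₁ gen _ _

    θ^-surjective : ∀ x → ¬ (x ≈ 0#) → ∃ λ b → b ℕ.< N ∧ θ ^ b ≈ x
    θ^-surjective = proj₂ gen

    θ≉0 : ¬ (θ ≈ 0#)
    θ≉0 θ≈0 = contradiction (θ^-injective (ℕ.<-trans (ℕ.s<s ℕ.z<s) 2<N) 2<N θ¹≈θ²) λ ()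
      where
      θ¹≈θ² : θ ^ 1 ≈ θ ^ 2
      θ¹≈θ² = trans (trans (*-identityʳ θ) θ≈0) (sym (trans (*-congʳ θ≈0) (zeroˡ _)))

    θ^N≈1 : θ ^ N ≈ 1#
    θ^N≈1 with θ^-surjective (θ ^ N) (x^n≉0 N θ≉0)
    ... | zero  , _   , θ^0≈θ^N = sym θ^0≈θ^N
    ... | suc b , b<N , θ^b≈θ^N =
      contradiction (θ^-injective N∸b<N (ℕ.<-trans ℕ.z<s 2<N) θ^[N∸b]≈θ^0) (ℕ.m<n⇒n≢0 (ℕ.m<n⇒0<n∸m b<N))
      where
      N∸b<N : N ℕ.∸ suc b ℕ.< N
      N∸b<N = ℕ.∸-monoʳ-< ℕ.z<s (ℕ.<⇒≤ b<N)
      θ^[N∸b]≈θ^0 : θ ^ (N ℕ.∸ suc b) ≈ θ ^ 0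
      θ^[N∸b]≈θ^0 = *-cancelˡ-≉0 (x^n≉0 (suc b) θ≉0) (begin
        θ ^ suc b * θ ^ (N ℕ.∸ suc b) ≈⟨ ^-homo-* θ (suc b) _ ⟨
        θ ^ (suc b ℕ.+ (N ℕ.∸ suc b)) ≡⟨ ≡.cong (θ ^_) (ℕ.m+[n∸m]≡n (ℕ.<⇒≤ b<N)) ⟩
        θ ^ N                         ≈⟨ θ^b≈θ^N ⟨
        θ ^ suc b                     ≈⟨ *-identityʳ _ ⟨
        θ ^ suc b * 1#                ∎)

    x≉0⇒x^N≈1 : ∀ {x} → ¬ (x ≈ 0#) → x ^ N ≈ 1#
    x≉0⇒x^N≈1 {x} x≉0 with θ^-surjective x x≉0
    ... | b , _ , θ^b≈x = begin
      x ^ N          ≈⟨ ^-congˡ N θ^b≈x ⟨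
      (θ ^ b) ^ N    ≈⟨ x^m^n≈x^n^m θ b N ⟩
      (θ ^ N) ^ b    ≈⟨ ^-congˡ b θ^N≈1 ⟩
      1# ^ b         ≈⟨ 1#^n≈1# b ⟩
      1#             ∎

    θ^-cong : ∀ {a b} → Cong N a b → θ ^ a ≈ θ ^ b
    θ^-cong {a} {b} (u , v , a+uN≡b+vN) = begin
      θ ^ a                  ≈⟨ *-identityʳ _ ⟨
      θ ^ a * 1#             ≈⟨ *-congˡ (θ^[k*N]≈1 u) ⟨
      θ ^ a * θ ^ (u ℕ.* N)  ≈⟨ ^-homo-* θ a _ ⟨
      θ ^ (a ℕ.+ u ℕ.* N)    ≡⟨ ≡.cong (θ ^_) a+uN≡b+vN ⟩
      θ ^ (b ℕ.+ v ℕ.* N)    ≈⟨ ^-homo-* θ b _ ⟩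
      θ ^ b * θ ^ (v ℕ.* N)  ≈⟨ *-congˡ (θ^[k*N]≈1 v) ⟩
      θ ^ b * 1#             ≈⟨ *-identityʳ _ ⟩
      θ ^ b                  ∎
      where
      θ^[k*N]≈1 : ∀ k → θ ^ (k ℕ.* N) ≈ 1#
      θ^[k*N]≈1 k = trans (^-congʳ θ (ℕ.*-comm k N)) (trans (sym (^-assocʳ θ N k)) (trans (^-congˡ k θ^N≈1) (1#^n≈1# k)))

    θ^≈⇒Cong : ∀ {a b} → θ ^ a ≈ θ ^ b → Cong N a b
    θ^≈⇒Cong {a} {b} θ^a≈θ^b = %≡⇒Cong (θ^-injective (m%n<n a N) (m%n<n b N) (begin
      θ ^ (a % N)  ≈⟨ θ^-cong (Cong-% a) ⟩
      θ ^ a        ≈⟨ θ^a≈θ^b ⟩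
      θ ^ b        ≈⟨ θ^-cong (Cong-% b) ⟨
      θ ^ (b % N)  ∎))

    powerSum : ℕ → Carrier
    powerSum j = ∑[ a < N ] ((θ ^ j) ^ toℕ a)

    powerSum≈0 : ∀ {j} → 0 ℕ.< j → j ℕ.< N → powerSum j ≈ 0#
    powerSum≈0 {j} 0<j j<N = geometric-sum≈0 {N} (x≉0⇒x^N≈1 (x^n≉0 j θ≉0)) λ θ^j≈1 →
      ℕ.<⇒≢ 0<j (≡.sym (θ^-injective j<N (ℕ.<-trans ℕ.z<s 2<N) θ^j≈1))

    powerSum≈N : ∀ {j} → θ ^ j ≈ 1# → powerSum j ≈ N × 1#
    powerSum≈N θ^j≈1 = trans (sum-cong-≋ {N} λ a → trans (^-congˡ (toℕ a) θ^j≈1) (1#^n≈1# (toℕ a))) (sum-replicate N)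

    ∑[θ^a+1]^N≈N+N : ∑[ a < N ] ((θ ^ toℕ a + 1#) ^ N) ≈ N × 1# + N × 1#
    ∑[θ^a+1]^N≈N+N = begin
      ∑[ a < N ] ((θ ^ toℕ a + 1#) ^ N)
        ≈⟨ sum-cong-≋ {N} (λ a → theorem N (θ ^ toℕ a) 1#) ⟩
      ∑[ a < N ] ∑[ i < suc N ] binomialTerm (θ ^ toℕ a) 1# N i
        ≈⟨ ∑-comm {N} {suc N} (λ a → binomialTerm (θ ^ toℕ a) 1# N) ⟩
      ∑[ i < suc N ] ∑[ a < N ] binomialTerm (θ ^ toℕ a) 1# N i
        ≈⟨ sum-cong-≋ {suc N} (λ i → trans (sum-cong-≋ {N} (λ a → ×-congʳ (N C toℕ i) (term i a)))
                                             (sum-× {N} (N C toℕ i) (λ a → (θ ^ toℕ i) ^ toℕ a))) ⟩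
      ∑[ i < suc N ] ((N C toℕ i) × powerSum (toℕ i))
        ≈⟨ sum-ends (λ i → (N C toℕ i) × powerSum (toℕ i))
                    (λ i 0<i i<N → trans (×-congʳ (N C toℕ i) (powerSum≈0 0<i i<N)) (×-zeroʳ (N C toℕ i))) ⟩
      1 × powerSum 0 + (N C toℕ (fromℕ N)) × powerSum (toℕ (fromℕ N))
        ≈⟨ +-cong (+-identityʳ (powerSum 0)) ([nCn]×g[n]≈g[n] N powerSum) ⟩
      powerSum 0 + powerSum N
        ≈⟨ +-cong (powerSum≈N {0} refl) (powerSum≈N {N} θ^N≈1) ⟩
      N × 1# + N × 1#
        ∎
      where
      term : ∀ i a → (θ ^ toℕ a) ^ toℕ i * 1# ^ (N ℕ.∸ toℕ i) ≈ (θ ^ toℕ i) ^ toℕ a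
      term i a = trans (*-congˡ (1#^n≈1# (N ℕ.∸ toℕ i))) (trans (*-identityʳ _) (x^m^n≈x^n^m θ (toℕ a) (toℕ i)))

    ∑[θ^a+1]^N+1≈N : ∑[ a < N ] ((θ ^ toℕ a + 1#) ^ N) + 1# ≈ N × 1#
    ∑[θ^a+1]^N+1≈N with θ^-surjective (- 1#) -1≉0
    ... | h , h<N , θ^h≈-1 = sum-count (λ a → (θ ^ toℕ a + 1#) ^ N) (fromℕ< h<N) vanishing nonvanishing
      where
      vanishing : (θ ^ toℕ (fromℕ< h<N) + 1#) ^ N ≈ 0#
      vanishing = trans (^-congˡ N θ^h+1≈0) (0#^n≈0# N)
        where
        θ^h+1≈0 : θ ^ toℕ (fromℕ< h<N) + 1# ≈ 0#
        θ^h+1≈0 = trans (+-congʳ (trans (^-congʳ θ (toℕ-fromℕ< h<N)) θ^h≈-1)) (-‿inverseˡ 1#)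
      nonvanishing : ∀ a → a ≢ fromℕ< h<N → (θ ^ toℕ a + 1#) ^ N ≈ 1#
      nonvanishing a a≢h = x≉0⇒x^N≈1 λ θ^a+1≈0 → a≢h (toℕ-injective (≡.trans
        (θ^-injective (toℕ<n a) h<N (trans (+-inverseˡ-unique _ _ θ^a+1≈0) (sym θ^h≈-1)))
        (≡.sym (toℕ-fromℕ< h<N))))

    characteristic : suc N × 1# ≈ 0#
    characteristic = +-cancelʳ (N × 1#) _ _ (begin
      1# + N × 1# + N × 1#                      ≈⟨ solve 1 (λ x → con 1 :+ x :+ x := x :+ x :+ con 1) refl (N × 1#) ⟩
      N × 1# + N × 1# + 1#                      ≈⟨ +-congʳ ∑[θ^a+1]^N≈N+N ⟨
      ∑[ a < N ] ((θ ^ toℕ a + 1#) ^ N) + 1#    ≈⟨ ∑[θ^a+1]^N+1≈N ⟩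
      N × 1#                                    ≈⟨ +-identityˡ _ ⟨
      0# + N × 1#                               ∎)

  module Characteristic (p : ℕ) (p×1≈0 : p × 1# ≈ 0#) where

    ∣⇒×≈0 : ∀ {n} x → p ∣ n → n × x ≈ 0#
    ∣⇒×≈0 x (divides-refl c) = begin
      (c ℕ.* p) × x           ≈⟨ n×x≈[n×1]*x (c ℕ.* p) x ⟩
      (c ℕ.* p) × 1# * x      ≈⟨ *-congʳ (×1-homo-* c p) ⟩
      c × 1# * (p × 1#) * x   ≈⟨ *-congʳ (*-congˡ p×1≈0) ⟩
      c × 1# * 0# * x         ≈⟨ *-congʳ (zeroʳ _) ⟩
      0# * x                  ≈⟨ zeroˡ x ⟩
      0#                      ∎

    module _ (p-prime : Prime p) where
      instance
        p≢0 : NonZero p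
        p≢0 = prime⇒nonZero p-prime

      ^p-homo-+ : ∀ x y → (x + y) ^ p ≈ x ^ p + y ^ p
      ^p-homo-+ x y = begin
        (x + y) ^ p                                            ≈⟨ theorem p x y ⟩
        ∑[ i < suc p ] binomialTerm x y p i                    ≈⟨ sum-ends _ (λ i 0<i i<p →
                                                                    ∣⇒×≈0 (binomial x y p i) (prime∣C p-prime 0<i i<p)) ⟩
        binomialTerm x y p zero + binomialTerm x y p (fromℕ p) ≈⟨ +-cong (binomialTerm-first x y p) (binomialTerm-last x y p) ⟩
        y ^ p + x ^ p                                          ≈⟨ +-comm _ _ ⟩
        x ^ p + y ^ p                                          ∎

      Tr≈1⇒Tr[^p]≈1 : ∀ q {u} → Tr q u ≈ 1# → Tr q (u ^ p) ≈ 1#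
      Tr≈1⇒Tr[^p]≈1 q {u} Tru≈1 = begin
        u ^ p + (u ^ p) ^ q  ≈⟨ +-congˡ (x^m^n≈x^n^m u p q) ⟩
        u ^ p + (u ^ q) ^ p  ≈⟨ ^p-homo-+ u (u ^ q) ⟨
        Tr q u ^ p           ≈⟨ ^-congˡ p Tru≈1 ⟩
        1# ^ p               ≈⟨ 1#^n≈1# p ⟩
        1#                   ∎

      Tr≈1⇒Tr[^p^e]≈1 : ∀ q e {u} → Tr q u ≈ 1# → Tr q (u ^ (p ℕ.^ e)) ≈ 1#
      Tr≈1⇒Tr[^p^e]≈1 q zero    Tru≈1 = trans (Tr-cong q (*-identityʳ _)) Tru≈1
      Tr≈1⇒Tr[^p^e]≈1 q (suc e) {u} Tru≈1 =
        trans (Tr-cong q (trans (^-congʳ u (ℕ.*-comm p (p ℕ.^ e))) (sym (^-assocʳ u (p ℕ.^ e) p))))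
              (Tr≈1⇒Tr[^p]≈1 q (Tr≈1⇒Tr[^p^e]≈1 q e Tru≈1))

module SidonSet {c ℓ : Level} (F : CommutativeRing c ℓ) (isField : FieldDefs.IsFieldRing F) where
  open CommutativeRing F hiding (zero)
  open FieldProperties F isField
  open FieldDefs F

  module _ {p q N : ℕ} (p-prime : Prime p) (p×1≈0 : p × 1# ≈ 0#) (2<N : 2 < N)
           {θ : Carrier} (gen : IsGenerator N θ) {p⁻¹ : ℕ} (p*p⁻¹∼1 : Cong N (p ℕ.* p⁻¹) 1)
           {st : ℕ → ℕ} (stc : IsCycleStartChoice p q N θ st) (k : ℕ) where
    open Generator 2<N gen
    open Characteristic p p×1≈0
    open Orbits p p⁻¹ p*p⁻¹∼1

    θ^[n*b]≈[θ^b]^n : ∀ n b → θ ^ (n ℕ.* b) ≈ (θ ^ b) ^ n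
    θ^[n*b]≈[θ^b]^n n b = trans (^-congʳ θ (ℕ.*-comm n b)) (sym (^-assocʳ θ b n))

    InB⇒Tr≈1 : ∀ {b} → InB q N θ b → Tr q (θ ^ b) ≈ 1#
    InB⇒Tr≈1 {b} (_ , θ^b+θ^[q*b]≈1) = trans (+-congˡ (sym (θ^[n*b]≈[θ^b]^n q b))) θ^b+θ^[q*b]≈1

    InB-p^e*x%N : ∀ e {x} → InB q N θ x → InB q N θ ((p ℕ.^ e ℕ.* x) % N)
    InB-p^e*x%N e {x} x∈B = m%n<n _ N , trans (+-congˡ (θ^[n*b]≈[θ^b]^n q _)) (begin
      Tr q (θ ^ ((p ℕ.^ e ℕ.* x) % N)) ≈⟨ Tr-cong q (trans (θ^-cong (Cong-% (p ℕ.^ e ℕ.* x)))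
                                                          (θ^[n*b]≈[θ^b]^n (p ℕ.^ e) x)) ⟩
      Tr q ((θ ^ x) ^ (p ℕ.^ e))      ≈⟨ Tr≈1⇒Tr[^p^e]≈1 p-prime q e (InB⇒Tr≈1 x∈B) ⟩
      1#                              ∎)
      where open import Relation.Binary.Reasoning.Setoid setoid

    st-≡-on-orbit : ∀ e {x y} → InB q N θ x → InB q N θ y → Cong N y (p ℕ.^ e ℕ.* x) → st y ≡ st x
    st-≡-on-orbit zero    {x} {y} x∈B y∈B y∼x =
      ≡.cong st (Cong-<⇒≡ (proj₁ y∈B) (proj₁ x∈B) (≡.subst (Cong N y) (ℕ.*-identityˡ x) y∼x))
    st-≡-on-orbit (suc e) {x} {y} x∈B y∈B y∼p^[1+e]x =
      ≡.trans (proj₂ stc z y (InB-p^e*x%N e x∈B) y∈B y∼p*z) (st-≡-on-orbit e x∈B (InB-p^e*x%N e x∈B) (Cong-% _))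
      where
      z : ℕ
      z = (p ℕ.^ e ℕ.* x) % N
      y∼p*z : Cong N y (p ℕ.* z)
      y∼p*z = Cong-trans (≡.subst (Cong N y) (ℕ.*-assoc p (p ℕ.^ e) x) y∼p^[1+e]x) (Cong-*ˡ p (Cong-sym (Cong-% _)))

    InA-not-shifted : ∀ {e x y} → 0 < e → e < k → InA k p q N θ st x → InA k p q N θ st y
             → Cong N y (p ℕ.^ e ℕ.* x) → ⊥
    InA-not-shifted {e} {x} {y} 0<e e<k
             (x∈B , m  , len[x]≡m  , k≤m , suc i  , ℕ.s≤s ℕ.z≤n , 1+i≤m   , k∣1+i  , x∼p^i*s)
             (y∈B , m′ , len[y]≡m′ , _   , suc i′ , ℕ.s≤s ℕ.z≤n , 1+i′≤m′ , k∣1+i′ , y∼p^i′*s′) y∼p^e*x =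
      multiples-not-shifted k≤m 0<e e<k 1+i≤m (≡.subst (suc i′ ≤_) m′≡m 1+i′≤m′) k∣1+i k∣1+i′ i′∼e+i
      where
      s : ℕ
      s = st x
      st[y]≡s : st y ≡ s
      st[y]≡s = st-≡-on-orbit e x∈B y∈B y∼p^e*x
      len[s]≡m : IsCycleLen N p s m
      len[s]≡m with proj₂ (proj₁ stc x x∈B)
      ... | d , p^d*x∼s = IsCycleLen-orbit {e = d} len[x]≡m (Cong-sym p^d*x∼s)
      len[s]≡m′ : IsCycleLen N p s m′
      len[s]≡m′ with proj₂ (proj₁ stc y y∈B)
      ... | d , p^d*y∼st[y] = IsCycleLen-orbit {e = d} len[y]≡m′ (Cong-sym (≡.subst (Cong N _) st[y]≡s p^d*y∼st[y]))
      m′≡m : m′ ≡ m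
      m′≡m = IsCycleLen-unique len[s]≡m′ len[s]≡m
      i′∼e+i : Cong m i′ (e ℕ.+ i)
      i′∼e+i = IsCycleLen-index len[s]≡m (begin
        p ℕ.^ i′ ℕ.* s                 ≈⟨ ≡.subst (λ s′ → Cong N y (p ℕ.^ i′ ℕ.* s′)) st[y]≡s y∼p^i′*s′ ⟨
        y                              ≈⟨ y∼p^e*x ⟩
        p ℕ.^ e ℕ.* x                  ≈⟨ Cong-*ˡ (p ℕ.^ e) x∼p^i*s ⟩
        p ℕ.^ e ℕ.* (p ℕ.^ i ℕ.* s)    ≡⟨ p^a*[p^b*x]≡p^[a+b]*x p e i s ⟩
        p ℕ.^ (e ℕ.+ i) ℕ.* s          ∎)
        where open import Relation.Binary.Reasoning.Setoid (Cong-setoid {N})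

    solution-trivial : ∀ {e x₁ x₂ x₃ x₄} → e < k
      → InA k p q N θ st x₁ → InA k p q N θ st x₂ → InA k p q N θ st x₃ → InA k p q N θ st x₄
      → Cong N (x₁ ℕ.+ p ℕ.^ e ℕ.* x₄) (x₂ ℕ.+ p ℕ.^ e ℕ.* x₃)
      → ¬ ¬ ((x₁ ≡ x₂ ∧ x₃ ≡ x₄) ⊎ (p ℕ.^ e ≡ 1 ∧ x₁ ≡ x₃ ∧ x₂ ≡ x₄))
    solution-trivial {e} {x₁} {x₂} {x₃} {x₄} e<k A₁ A₂ A₃ A₄ sol ¬trivial =
      Tr≈1-sidon q (Tr≈1 A₁) (Tr≈1 A₂) (Tr[^p^e]≈1 A₃) (Tr[^p^e]≈1 A₄) u₁w₄≈u₂w₃ λ sidon-case →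
        ¬trivial (from-sidon sidon-case)
      where
      Tr≈1 : ∀ {x} → InA k p q N θ st x → Tr q (θ ^ x) ≈ 1#
      Tr≈1 (x∈B , _) = InB⇒Tr≈1 x∈B
      Tr[^p^e]≈1 : ∀ {x} → InA k p q N θ st x → Tr q ((θ ^ x) ^ (p ℕ.^ e)) ≈ 1#
      Tr[^p^e]≈1 A = Tr≈1⇒Tr[^p^e]≈1 p-prime q e (Tr≈1 A)
      <N : ∀ {x} → InA k p q N θ st x → x < N
      <N ((x<N , _) , _) = x<N
      θ^[a+p^e*b] : ∀ a b → θ ^ (a ℕ.+ p ℕ.^ e ℕ.* b) ≈ θ ^ a * (θ ^ b) ^ (p ℕ.^ e)
      θ^[a+p^e*b] a b = trans (^-homo-* θ a _) (*-congˡ (θ^[n*b]≈[θ^b]^n (p ℕ.^ e) b))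
      u₁w₄≈u₂w₃ : θ ^ x₁ * (θ ^ x₄) ^ (p ℕ.^ e) ≈ θ ^ x₂ * (θ ^ x₃) ^ (p ℕ.^ e)
      u₁w₄≈u₂w₃ = trans (sym (θ^[a+p^e*b] x₁ x₄)) (trans (θ^-cong sol) (θ^[a+p^e*b] x₂ x₃))
      ≈⇒Cong[p^e*] : ∀ {a b} → θ ^ a ≈ (θ ^ b) ^ (p ℕ.^ e) → Cong N a (p ℕ.^ e ℕ.* b)
      ≈⇒Cong[p^e*] {a} {b} eq = θ^≈⇒Cong (trans eq (sym (θ^[n*b]≈[θ^b]^n (p ℕ.^ e) b)))
      from-sidon : (θ ^ x₁ ≈ θ ^ x₂ ∧ (θ ^ x₄) ^ (p ℕ.^ e) ≈ (θ ^ x₃) ^ (p ℕ.^ e))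
                 ⊎ (θ ^ x₁ ≈ (θ ^ x₃) ^ (p ℕ.^ e) ∧ (θ ^ x₄) ^ (p ℕ.^ e) ≈ θ ^ x₂)
                 → (x₁ ≡ x₂ ∧ x₃ ≡ x₄) ⊎ (p ℕ.^ e ≡ 1 ∧ x₁ ≡ x₃ ∧ x₂ ≡ x₄)
      from-sidon (inj₁ (u₁≈u₂ , w₄≈w₃)) = inj₁
        ( Cong-<⇒≡ (<N A₁) (<N A₂) (θ^≈⇒Cong u₁≈u₂)
        , Cong-<⇒≡ (<N A₃) (<N A₄) (*-cancelˡ-p^ e (Cong-sym (≈⇒Cong[p^e*]
            (trans (θ^[n*b]≈[θ^b]^n (p ℕ.^ e) x₄) w₄≈w₃)))))
      from-sidon (inj₂ (u₁≈w₃ , w₄≈u₂)) with e ℕ.≟ 0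
      ... | yes e≡0 = inj₂
        ( ≡.cong (p ℕ.^_) e≡0
        , Cong-<⇒≡ (<N A₁) (<N A₃) (≡.subst (Cong N x₁) (p^e*x≡x x₃) (≈⇒Cong[p^e*] u₁≈w₃))
        , Cong-<⇒≡ (<N A₂) (<N A₄) (≡.subst (Cong N x₂) (p^e*x≡x x₄) (≈⇒Cong[p^e*] (sym w₄≈u₂))))
        where
        p^e*x≡x : ∀ x → p ℕ.^ e ℕ.* x ≡ x
        p^e*x≡x x = ≡.trans (≡.cong (λ n → p ℕ.^ n ℕ.* x) e≡0) (ℕ.*-identityˡ x)
      ... | no  e≢0 = ⊥-elim (InA-not-shifted (ℕ.n≢0⇒n>0 e≢0) e<k A₃ A₁ (≈⇒Cong[p^e*] u₁≈w₃))

-- Imported only now: these operators clash with those of the ring in the modules above.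
open import Data.Nat.Base using (_+_; _*_; _∸_; _^_)
open import Data.Product.Base using (_×_)

lemma3p2 : {c ℓ : Level} (k p M r i t q : ℕ) → 2 ≤ k → Prime p → 1 ≤ M → Prime r
    → M * k < r → 1 ≤ i → t ≡ r ^ i → q ≡ p ^ t
    → (F : CommutativeRing c ℓ) → FieldDefs.IsFieldRing F
    → (θ : CommutativeRing.Carrier F) → FieldDefs.IsGenerator F (q * q ∸ 1) θ
    → (st : ℕ → ℕ) → FieldDefs.IsCycleStartChoice F p q (q * q ∸ 1) θ st
    → (e : ℕ) → e < k
    → (x₁ x₂ x₃ x₄ : ℕ)
    → FieldDefs.InA F k p q (q * q ∸ 1) θ st x₁
    → FieldDefs.InA F k p q (q * q ∸ 1) θ st x₂
    → FieldDefs.InA F k p q (q * q ∸ 1) θ st x₃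
    → FieldDefs.InA F k p q (q * q ∸ 1) θ st x₄
    → Cong (q * q ∸ 1) (x₁ + (p ^ e) * x₄) (x₂ + (p ^ e) * x₃)
    → (x₁ ≡ x₂ × x₃ ≡ x₄) ⊎ (p ^ e ≡ 1 × x₁ ≡ x₃ × x₂ ≡ x₄)
lemma3p2 k p M r i t q _ p-prime _ r-prime _ _ t≡r^i q≡p^t F isField θ gen st stc e e<k x₁ x₂ x₃ x₄ A₁ A₂ A₃ A₄ sol =
  decidable-stable trivial? λ ¬trivial →
    [m^n]×1≈0⇒¬¬m×1≈0 (t + t) (trans (×-congˡ (≡.sym 1+N≡p^[t+t])) characteristic) λ p×1≈0 →
      SidonSet.solution-trivial F isField {q = q} p-prime p×1≈0 2<N gen p*p^[t+t∸1]∼1 stc k e<k A₁ A₂ A₃ A₄ sol ¬trivial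
  where
  open CommutativeRing F using (trans)
  open FieldProperties F isField using (×-congˡ; [m^n]×1≈0⇒¬¬m×1≈0)
  N : ℕ
  N = q * q ∸ 1
  trivial? : Dec ((x₁ ≡ x₂ × x₃ ≡ x₄) ⊎ (p ^ e ≡ 1 × x₁ ≡ x₃ × x₂ ≡ x₄))
  trivial? = ((x₁ ℕ.≟ x₂) ×-dec (x₃ ℕ.≟ x₄))
         ⊎-dec ((p ^ e ℕ.≟ 1) ×-dec ((x₁ ℕ.≟ x₃) ×-dec (x₂ ℕ.≟ x₄)))
  1≤t : 1 ≤ t
  1≤t = ≡.subst (1 ≤_) (≡.sym t≡r^i) (ℕ.m^n>0 r {{prime⇒nonZero r-prime}} i)
  2≤q : 2 ≤ q
  2≤q = ≡.subst (2 ≤_) (≡.sym q≡p^t) (prime^≥2 p-prime 1≤t)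
  2<N : 2 < N
  2<N = 2<q*q∸1 2≤q
  open FieldProperties.Generator F isField 2<N gen using (characteristic)
  1+N≡p^[t+t] : 1 + N ≡ p ^ (t + t)
  1+N≡p^[t+t] = ≡.trans (ℕ.m+[n∸m]≡n (ℕ.≤-trans (ℕ.s≤s ℕ.z≤n) (ℕ.*-mono-≤ 2≤q 2≤q)))
                        (≡.trans (≡.cong (λ n → n * n) q≡p^t) (≡.sym (ℕ.^-distribˡ-+-* p t t)))
  p*p^[t+t∸1]∼1 : Cong N (p * p ^ (t + t ∸ 1)) 1
  p*p^[t+t∸1]∼1 = ≡.subst (λ n → Cong N n 1)
    (≡.trans 1+N≡p^[t+t] (≡.cong (p ^_) (≡.sym (ℕ.m+[n∸m]≡n (ℕ.≤-trans 1≤t (ℕ.m≤m+n t t)))))) (0 , 1 , ≡.refl)
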